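{- The cut polytope $\operatorname{Cut}^{\Box}(K_5)$ of the complete graph on five vertices is not seminormal. In particular, it is not normal.
   Context: For a graph $G=(V,E)$ and $A\subseteq V$ the cut vector $\delta_A\in\mathbb{R}^E$ has $\delta_{A,e}=1$ if $|A\cap e|=1$ and $0$ otherwise; $\operatorname{Cut}^{\Box}(G)=\operatorname{conv}\{\delta_A:A\subseteq V\}$, and $M_G$ is the affine monoid generated by the vectors $(\delta_A,1)\in\mathbb{Z}^{E}\times\mathbb{Z}$. A monoid $M$ with group $\operatorname{gp}(M)$ is seminormal if every $x\in\operatorname{gp}(M)$ with $2x,3x\in M$ satisfies $x\in M$; it is normal if every $x\in\operatorname{gp}(M)$ with $nx\in M$ for some positive integer $n$ lies in $M$. The cut polytope is called (semi)normal if $M_G$ is (equivalently, if the cut algebra $\mathbb{K}[M_G]$ over a field $\mathbb{K}$ is). -}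

module Defs where

open import Data.Nat using (ℕ; suc; _≥_)
open import Data.Integer using (ℤ; +_; _+_; _-_; _*_)
open import Data.Bool using (Bool; true; false; _xor_; if_then_else_)
open import Data.Fin using (Fin; _<?_)
open import Data.Fin.Subset using (Subset)
open import Data.List using (List; []; _∷_; length; filter; cartesianProduct; allFin)
open import Data.Vec using (Vec; []; _∷_; lookup; zipWith; replicate; map; fromList; _∷ʳ_)
open import Data.Product using (_×_; _,_; proj₁; proj₂; ∃; ∃₂)
open import Relation.Binary.PropositionalEquality using (_≡_)

record Graph : Set where
  field
    nV    : ℕ
    edges : List (Fin nV × Fin nV)

open Graph public

nE : Graph → ℕ
nE G = length (edges G)

Lattice : Graph → Set
Lattice G = Vec ℤ (suc (nE G))

K : ℕ → Graph
K n = record { nV = n ; edges = filter (λ p → proj₁ p <? proj₂ p) (cartesianProduct (allFin n) (allFin n)) }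

cutVec : (G : Graph) → Subset (nV G) → Vec ℤ (nE G)
cutVec G A = map (λ e → if lookup A (proj₁ e) xor lookup A (proj₂ e) then + 1 else + 0) (fromList (edges G))

gen : (G : Graph) → Subset (nV G) → Lattice G
gen G A = cutVec G A ∷ʳ + 1

zeroV : ∀ {k} → Vec ℤ k
zeroV = replicate _ (+ 0)

_⊕_ : ∀ {k} → Vec ℤ k → Vec ℤ k → Vec ℤ k
_⊕_ = zipWith _+_

_⊖_ : ∀ {k} → Vec ℤ k → Vec ℤ k → Vec ℤ k
_⊖_ = zipWith _-_

_·_ : ∀ {k} → ℕ → Vec ℤ k → Vec ℤ k
m · v = map (λ z → + m * z) v

sumGens : (G : Graph) → List (Subset (nV G)) → Lattice G
sumGens G [] = zeroV
sumGens G (A ∷ As) = gen G A ⊕ sumGens G As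

InM : (G : Graph) → Lattice G → Set
InM G x = ∃ λ (As : List (Subset (nV G))) → sumGens G As ≡ x

InGp : (G : Graph) → Lattice G → Set
InGp G x = ∃₂ λ (Ps Ns : List (Subset (nV G))) → sumGens G Ps ⊖ sumGens G Ns ≡ x

Seminormal : Graph → Set
Seminormal G = ∀ x → InGp G x → InM G (2 · x) → InM G (3 · x) → InM G x

Normal : Graph → Set
Normal G = ∀ x → InGp G x → ∀ (m : ℕ) → m ≥ 1 → InM G (m · x) → InM G x

-- Take x₀ = (2,…,2 ; 4). Then 3x₀ = 2δ_∅ + Σ_{|A|=2} δ_A and 2x₀ is a sum of eight
-- cuts, so x₀ = 3x₀ − 2x₀ lies in gp(M) with 2x₀, 3x₀ ∈ M. But x₀ ∉ M: by its last
-- coordinate it would be a sum of exactly four cuts, each edge cut twice, i.e. five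
-- vertex labels in {0,1}⁴ at pairwise Hamming distance 2, and at most four such labels
-- exist. Since δ_A = δ_(∁A), this is a finite search over the 16 cuts avoiding vertex 0.
module Submission where

open import Defs
open import Algebra.Properties.AbelianGroup using (xyx⁻¹≈y; //-rightDividesʳ)
open import Data.Bool using (Bool; true; false; not; _xor_; if_then_else_; T)
open import Data.Bool.ListAction using (any)
open import Data.Bool.Properties using (not-distribˡ-xor; not-distribʳ-xor; not-involutive)
open import Data.Fin using (fromℕ)
open import Data.Fin.Subset using (Subset; ⊥; ∁; ∣_∣)
open import Data.Integer using (ℤ; +_; _+_; _-_; _*_)
import Data.Integer.Properties as ℤ
open import Data.List using (List; []; _∷_; length; map; _++_; filter)
open import Data.List.Membership.Propositional using (_∈_)
open import Data.List.Membership.Propositional.Properties using (∈-map⁺; ∈-++⁺ˡ; ∈-++⁺ʳ)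
open import Data.List.Relation.Unary.Any as Any using (here)
open import Data.List.Relation.Unary.Any.Properties using (any⁺)
open import Data.Nat using (ℕ; zero; suc; s≤s; z≤n)
import Data.Nat as ℕ
open import Data.Product using (_×_; _,_; proj₁; proj₂)
open import Data.Sum using (_⊎_; inj₁; inj₂)
open import Data.Vec using (Vec; []; _∷_; _∷ʳ_; lookup; replicate; fromList)
open import Data.Vec.Properties using (≡-dec; lookup-zipWith; lookup-replicate; lookup-map; map-cong)
open import Function using (_∘_)
open import Relation.Nullary using (¬_)
open import Relation.Nullary.Decidable using (⌊_⌋; fromWitness)
open import Relation.Binary.PropositionalEquality

⊕-⊖-cancelˡ : ∀ {k} (u v : Vec ℤ k) → (u ⊕ v) ⊖ u ≡ v
⊕-⊖-cancelˡ []       []       = refl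
⊕-⊖-cancelˡ (x ∷ xs) (y ∷ ys) =
  cong₂ _∷_ (xyx⁻¹≈y ℤ.+-0-abelianGroup x y) (⊕-⊖-cancelˡ xs ys)

suc·-⊖-· : ∀ {k} m (x : Vec ℤ k) → (suc m · x) ⊖ (m · x) ≡ x
suc·-⊖-· m []      = refl
suc·-⊖-· m (z ∷ x) = cong₂ _∷_ suc*-*-cancel (suc·-⊖-· m x)
  where
  suc*-*-cancel : + suc m * z - + m * z ≡ z
  suc*-*-cancel = begin
    + suc m * z - + m * z    ≡⟨ cong (_- + m * z) (ℤ.suc-* (+ m) z) ⟩
    z + + m * z - + m * z    ≡⟨ //-rightDividesʳ ℤ.+-0-abelianGroup (+ m * z) z ⟩
    z                        ∎
    where open ≡-Reasoning

InGp-suc·-· : ∀ G {x} m → InM G (suc m · x) → InM G (m · x) → InGp G x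
InGp-suc·-· G {x} m (Ps , ΣPs) (Ns , ΣNs) =
  Ps , Ns , trans (cong₂ _⊖_ ΣPs ΣNs) (suc·-⊖-· m x)

normal⇒seminormal : ∀ {G} → Normal G → Seminormal G
normal⇒seminormal normal x x∈gp 2x∈M _ = normal x x∈gp 2 (s≤s z≤n) 2x∈M

degree : (G : Graph) → Lattice G → ℤ
degree G x = lookup x (fromℕ (nE G))

lookup-∷ʳ-fromℕ : ∀ {A : Set} {n} (xs : Vec A n) (y : A) → lookup (xs ∷ʳ y) (fromℕ n) ≡ y
lookup-∷ʳ-fromℕ []       y = refl
lookup-∷ʳ-fromℕ (x ∷ xs) y = lookup-∷ʳ-fromℕ xs y

degree-sumGens : ∀ G As → degree G (sumGens G As) ≡ + length As
degree-sumGens G []       = lookup-replicate (fromℕ (nE G)) (+ 0)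
degree-sumGens G (A ∷ As) = begin
  degree G (gen G A ⊕ sumGens G As)            ≡⟨ lookup-zipWith _+_ (fromℕ (nE G)) (gen G A) (sumGens G As) ⟩
  degree G (gen G A) + degree G (sumGens G As) ≡⟨ cong₂ _+_ (lookup-∷ʳ-fromℕ (cutVec G A) (+ 1)) (degree-sumGens G As) ⟩
  + suc (length As)                            ∎
  where open ≡-Reasoning

xor-not-not : ∀ a b → not a xor not b ≡ a xor b
xor-not-not a b = begin
  not a xor not b     ≡⟨ sym (not-distribˡ-xor a (not b)) ⟩
  not (a xor not b)   ≡⟨ cong not (sym (not-distribʳ-xor a b)) ⟩
  not (not (a xor b)) ≡⟨ not-involutive (a xor b) ⟩
  a xor b             ∎
  where open ≡-Reasoning

gen-∁ : ∀ G A → gen G (∁ A) ≡ gen G A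
gen-∁ G A = cong (_∷ʳ + 1) (map-cong cut-∁ (fromList (edges G)))
  where
  cut-∁ : ∀ e → (if lookup (∁ A) (proj₁ e) xor lookup (∁ A) (proj₂ e) then + 1 else + 0)
                ≡ (if lookup A (proj₁ e) xor lookup A (proj₂ e) then + 1 else + 0)
  cut-∁ (u , v) rewrite lookup-map u not A | lookup-map v not A
                      | xor-not-not (lookup A u) (lookup A v) = refl

subsets : ∀ n → List (Subset n)
subsets zero    = [] ∷ []
subsets (suc n) = map (false ∷_) (subsets n) ++ map (true ∷_) (subsets n)

∈-subsets : ∀ {n} (A : Subset n) → A ∈ subsets n
∈-subsets []          = here refl
∈-subsets (false ∷ A) = ∈-++⁺ˡ (∈-map⁺ (false ∷_) (∈-subsets A))
∈-subsets (true ∷ A)  = ∈-++⁺ʳ _ (∈-map⁺ (true ∷_) (∈-subsets A))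

avoiding0 : ∀ n → List (Subset (suc n))
avoiding0 n = map (false ∷_) (subsets n)

∈-avoiding0-or-∁ : ∀ {n} (A : Subset (suc n)) → A ∈ avoiding0 n ⊎ ∁ A ∈ avoiding0 n
∈-avoiding0-or-∁ (false ∷ A) = inj₁ (∈-map⁺ (false ∷_) (∈-subsets A))
∈-avoiding0-or-∁ (true ∷ A)  = inj₂ (∈-map⁺ (false ∷_) (∈-subsets (∁ A)))

gen-∈-map-gen : ∀ G {reps} → (∀ A → A ∈ reps ⊎ ∁ A ∈ reps) → ∀ A → gen G A ∈ map (gen G) reps
gen-∈-map-gen G reps-cover A with reps-cover A
... | inj₁ A∈reps  = ∈-map⁺ (gen G) A∈reps
... | inj₂ ∁A∈reps = subst (_∈ _) (gen-∁ G A) (∈-map⁺ (gen G) ∁A∈reps)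

isSumOf : ∀ {k} → List (Vec ℤ k) → ℕ → Vec ℤ k → Bool
isSumOf gs zero    x = ⌊ ≡-dec ℤ._≟_ x zeroV ⌋
isSumOf gs (suc n) x = any (λ g → isSumOf gs n (x ⊖ g)) gs

isSumOf-sumGens : ∀ G {gs} → (∀ A → gen G A ∈ gs) → ∀ As → T (isSumOf gs (length As) (sumGens G As))
isSumOf-sumGens G cover [] = fromWitness refl
isSumOf-sumGens G cover (A ∷ As) = any⁺ _ (Any.map peel (cover A))
  where
  peel : ∀ {g} → gen G A ≡ g → T (isSumOf _ (length As) ((gen G A ⊕ sumGens G As) ⊖ g))
  peel refl rewrite ⊕-⊖-cancelˡ (gen G A) (sumGens G As) = isSumOf-sumGens G cover As

x₀ : Lattice (K 5)
x₀ = replicate 10 (+ 2) ∷ʳ + 4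

cutsK5 : List (Lattice (K 5))
cutsK5 = map (gen (K 5)) (avoiding0 4)

-- Decided by evaluating all 16⁴ sums of four cuts.
x₀-not-sum-of-four-cuts : ¬ T (isSumOf cutsK5 4 x₀)
x₀-not-sum-of-four-cuts ()

x₀∉M : ¬ InM (K 5) x₀
x₀∉M (As , ΣAs≡x₀) = x₀-not-sum-of-four-cuts
  (subst₂ (λ n x → T (isSumOf cutsK5 n x)) length≡4 ΣAs≡x₀ As-decomposes)
  where
  As-decomposes : T (isSumOf cutsK5 (length As) (sumGens (K 5) As))
  As-decomposes = isSumOf-sumGens (K 5) (gen-∈-map-gen (K 5) ∈-avoiding0-or-∁) As
  length≡4 : length As ≡ 4
  length≡4 = ℤ.+-injective (trans (sym (degree-sumGens (K 5) As)) (cong (degree (K 5)) ΣAs≡x₀))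

twelveCuts : List (Subset 5)
twelveCuts = ⊥ ∷ ⊥ ∷ filter ((ℕ._≟ 2) ∘ ∣_∣) (subsets 5)

-- The cuts δ_(S ∪ T) with S ⊆ {1} and T ∈ {∅, {2,3}, {2,4}, {3,4}}.
eightCuts : List (Subset 5)
eightCuts =
  (false ∷ false ∷ false ∷ false ∷ false ∷ []) ∷
  (false ∷ true  ∷ false ∷ false ∷ false ∷ []) ∷
  (false ∷ false ∷ true  ∷ true  ∷ false ∷ []) ∷
  (false ∷ true  ∷ true  ∷ true  ∷ false ∷ []) ∷
  (false ∷ false ∷ true  ∷ false ∷ true  ∷ []) ∷
  (false ∷ true  ∷ true  ∷ false ∷ true  ∷ []) ∷
  (false ∷ false ∷ false ∷ true  ∷ true  ∷ []) ∷
  (false ∷ true  ∷ false ∷ true  ∷ true  ∷ []) ∷ []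

2x₀∈M : InM (K 5) (2 · x₀)
2x₀∈M = eightCuts , refl

3x₀∈M : InM (K 5) (3 · x₀)
3x₀∈M = twelveCuts , refl

¬Seminormal-K5 : ¬ Seminormal (K 5)
¬Seminormal-K5 seminormal = x₀∉M (seminormal x₀ (InGp-suc·-· (K 5) 2 3x₀∈M 2x₀∈M) 2x₀∈M 3x₀∈M)

theorem4p3 : ¬ Seminormal (K 5) × ¬ Normal (K 5)
theorem4p3 = ¬Seminormal-K5 , ¬Seminormal-K5 ∘ normal⇒seminormal
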